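{- Let $k,\ell$ be positive integers with $k\geq 3$. (i) If $\ell>\lfloor k/2\rfloor$, then $rx_{k,\ell}(K_{n})\geq k$ for every integer $n\geq k$. (ii) If $\ell\leq\lfloor k/2\rfloor$, then $rx_{k,\ell}(K_{n})\geq k$ for every integer $n\geq R_{k-1}(k)$.
   Context: An edge-coloring of a graph $G$ is any map $c:E(G)\to\{1,\dots,t\}$ (adjacent edges may receive the same color). A tree is rainbow if no two of its edges have the same color. For $S\subseteq V(G)$, a rainbow $S$-tree is a rainbow tree in $G$ whose vertex set contains $S$. $S$-trees $T_1,\dots,T_\ell$ are internally disjoint if $E(T_i)\cap E(T_j)=\emptyset$ and $V(T_i)\cap V(T_j)=S$ for all $i\ne j$. For $k\ge2$, $\ell\ge1$, $rx_{k,\ell}(G)$ is the minimum number of colors in an edge-coloring of $G$ such that for every $k$-subset $S\subseteq V(G)$ there exist $\ell$ internally disjoint rainbow $S$-trees. $K_n$ is the complete graph on $n$ vertices. The multicolor Ramsey number $R_{r}(t)$ is the smallest integer $n$ such that every $r$-edge-coloring of $K_n$ contains a complete subgraph on $t$ vertices all of whose edges have the same color. -}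

module Defs where

open import Data.Nat using (ℕ; zero; suc; _≤_; _<_; _≥_; _⊓_; _∸_; _/_)
open import Data.Fin using (Fin) renaming (_<_ to _<ᶠ_)
open import Data.Product using (Σ; ∃; ∃-syntax; _×_; _,_)
open import Data.Sum using (_⊎_)
open import Data.List using (List; []; _∷_; length; map; _++_; [_])
open import Data.List.Membership.Propositional using (_∈_)
open import Data.List.Relation.Unary.All using (All)
open import Data.List.Relation.Unary.Unique.Propositional using (Unique)
open import Relation.Binary.PropositionalEquality using (_≡_; _≢_)
open import Relation.Nullary using (¬_)
open import Data.Empty using (⊥)

-- Edge-colorings of K_n (vertex set Fin n) with colors Fin t (= {1,…,t}).
-- A coloring is a symmetric function on pairs; its diagonal is irrelevant.
record Coloring (n t : ℕ) : Set where
  field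
    col : Fin n → Fin n → Fin t
    sym : ∀ u v → col u v ≡ col v u
open Coloring public

-- An edge of K_n, represented canonically as an ordered pair (u , v) with u < v.
Edge : ℕ → Set
Edge n = Fin n × Fin n

Canonical : {n : ℕ} → Edge n → Set
Canonical (u , v) = u <ᶠ v

Adj : {n : ℕ} → List (Edge n) → Fin n → Fin n → Set
Adj E u v = ((u , v) ∈ E) ⊎ ((v , u) ∈ E)

data Walk {n : ℕ} (E : List (Edge n)) : Fin n → Fin n → Set where
  here : ∀ {u} → Walk E u u
  step : ∀ {u w v} → Adj E u w → Walk E w v → Walk E u v

data Chain {n : ℕ} (E : List (Edge n)) : List (Fin n) → Set where
  nil  : Chain E []
  one  : ∀ {x} → Chain E (x ∷ [])
  cons : ∀ {x y xs} → Adj E x y → Chain E (y ∷ xs) → Chain E (x ∷ y ∷ xs)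

HasCycle : {n : ℕ} → List (Edge n) → Set
HasCycle {n} E = Σ (Fin n) λ x → Σ (List (Fin n)) λ xs →
  Unique (x ∷ xs) × (2 ≤ length xs) × Chain E (x ∷ xs ++ [ x ])

record Tree (n : ℕ) : Set where
  field
    V : List (Fin n)
    E : List (Edge n)
    V-unique  : Unique V
    E-unique  : Unique E
    E-canon   : All Canonical E
    E-inV     : All (λ e → (Data.Product.proj₁ e ∈ V) × (Data.Product.proj₂ e ∈ V)) E
    connected : ∀ u v → u ∈ V → v ∈ V → Walk E u v
    acyclic   : ¬ HasCycle E
open Tree public

Rainbow : {n t : ℕ} → Coloring n t → Tree n → Set
Rainbow c T = Unique (map (λ e → col c (Data.Product.proj₁ e) (Data.Product.proj₂ e)) (E T))

IsSTree : {n : ℕ} → List (Fin n) → Tree n → Set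
IsSTree S T = ∀ x → x ∈ S → x ∈ V T

InternallyDisjoint : {n : ℕ} → List (Fin n) → Tree n → Tree n → Set
InternallyDisjoint S T₁ T₂ =
  (∀ e → e ∈ E T₁ → e ∈ E T₂ → ⊥) × (∀ x → x ∈ V T₁ → x ∈ V T₂ → x ∈ S)

KSubset : (n k : ℕ) → List (Fin n) → Set
KSubset n k S = Unique S × (length S ≡ k)

RainbowKL : (k ℓ : ℕ) {n t : ℕ} → Coloring n t → Set
RainbowKL k ℓ {n} c = ∀ (S : List (Fin n)) → KSubset n k S →
  Σ (Fin ℓ → Tree n) λ T →
    (∀ i → IsSTree S (T i) × Rainbow c (T i)) ×
    (∀ i j → i ≢ j → InternallyDisjoint S (T i) (T j))

-- rx_{k,ℓ}(K_n) ≥ m : no edge-coloring with fewer than m colors is (k,ℓ)-rainbow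
-- (if no coloring at all works, rx is +∞ and this holds).
RxAtLeast : (k ℓ n m : ℕ) → Set
RxAtLeast k ℓ n m = ∀ t → t < m → (c : Coloring n t) → ¬ RainbowKL k ℓ c

RamseyProperty : (r t N : ℕ) → Set
RamseyProperty r t N = (c : Coloring N r) →
  Σ (List (Fin N)) λ X → Σ (Fin r) λ a →
    KSubset N t X × (∀ u v → u ∈ X → v ∈ X → u ≢ v → col c u v ≡ a)

IsRamseyNumber : (r t N : ℕ) → Set
IsRamseyNumber r t N = RamseyProperty r t N × (∀ M → M < N → ¬ RamseyProperty r t M)

module Submission where

-- Fix a colouring c of K_n with t < k colours and a k-subset S.  A rainbow
-- S-tree T has at most t ≤ k - 1 edges, and being connected it has at most
-- |E(T)| + 1 ≤ k vertices; as it contains the k vertices of S, its vertex set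
-- is exactly S and it has at least k - 1 edges (`small-rainbow-S-tree`).
--
-- (ii) If n ≥ R_{k-1}(k), the colouring restricted to the first R_{k-1}(k)
--   vertices has a monochromatic K_k on some S; a rainbow S-tree lives inside S
--   and has k - 1 ≥ 2 edges of one colour, so it is not rainbow.
-- (i) If ℓ > ⌊k/2⌋, take S to be the first k vertices.  The ℓ trees are
--   edge-disjoint and use only edges inside S, so ℓ (k - 1) ≤ k (k - 1) / 2,
--   i.e. 2ℓ ≤ k, a contradiction.

open import Defs hiding (sym)
open import Data.Nat using (ℕ; suc; _≤_; _<_; _≥_; _>_; _/_; _∸_; _+_; _*_; z≤n; s≤s)
open import Data.Nat.Properties
open import Data.Nat.DivMod using (/-monoˡ-≤; m*n/n≡m)
open import Data.Nat.Tactic.RingSolver using (solve-∀)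
open import Data.Product using (_×_; _,_; proj₁; proj₂; Σ; swap)
open import Data.Sum using (_⊎_; inj₁; inj₂)
open import Data.Fin as Fin using (Fin; inject≤)
import Data.Fin.Properties as FinP
open import Data.List using (List; []; _∷_; length; map; _++_; filter; allFin; cartesianProduct; concatMap)
open import Data.List.Properties using (length-map; length-++; filter-all; length-tabulate)
open import Data.List.Relation.Unary.Any using (here; there)
open import Data.List.Relation.Unary.All as All using (All; []; _∷_)
open import Data.List.Relation.Unary.All.Properties using (¬Any⇒All¬)
open import Data.List.Relation.Unary.AllPairs using ([]; _∷_)
open import Data.List.Relation.Unary.Unique.Propositional using (Unique)
import Data.List.Relation.Unary.Unique.Propositional.Properties as UniqueP
open import Data.List.Membership.Propositional using (_∈_)
open import Data.List.Membership.Propositional.Properties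
  using (∈-map⁻; ∈-++⁻; ∈-filter⁻; ∈-allFin; ∈-cartesianProduct⁺)
import Data.List.Membership.DecPropositional as DecMembership
open import Relation.Binary.Definitions using (DecidableEquality)
open import Relation.Binary.PropositionalEquality
open import Relation.Nullary using (¬_; yes; no; ¬?)
open import Relation.Unary using (Pred; Decidable)
open import Data.Empty using (⊥; ⊥-elim)
open import Function using (_∘_)

floor-half<⇒< : ∀ k ℓ → k / 2 < ℓ → k < ℓ * 2
floor-half<⇒< k ℓ k/2<ℓ = ≰⇒> λ ℓ*2≤k →
  <⇒≱ k/2<ℓ (subst (_≤ k / 2) (m*n/n≡m ℓ 2) (/-monoˡ-≤ 2 ℓ*2≤k))

-- If q > k ≥ 2 then q k + k > k² + q  (i.e. q (k - 1) > k (k - 1)).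
no-room : ∀ k q → 2 ≤ k → k < q → q * k + k ≤ k * k + q → ⊥
no-room k q 2≤k k<q h with m≤n⇒∃[o]m+o≡n k<q
... | d , refl = <⇒≱ 2≤k (*-cancelˡ-≤ (suc d) (+-cancelˡ-≤ (k * k + k) _ _ rearranged))
  where
    expand-lhs : ∀ k d → (suc k + d) * k + k ≡ (k * k + k) + suc d * k
    expand-lhs = solve-∀
    expand-rhs : ∀ k d → k * k + (suc k + d) ≡ (k * k + k) + suc d * 1
    expand-rhs = solve-∀
    rearranged : (k * k + k) + suc d * k ≤ (k * k + k) + suc d * 1
    rearranged = subst₂ _≤_ (expand-lhs k d) (expand-rhs k d) h

-- The edge count of part (i): ℓ trees with ≥ k - 1 edges each (m edges in
-- total) fit into the k (k - 1) / 2 pairs of S only if 2ℓ ≤ k.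
too-many-edges : ∀ k ℓ m → 2 ≤ k → k < ℓ * 2 → ℓ * k ≤ m + ℓ → m + (m + k) ≤ k * k → ⊥
too-many-edges k ℓ m 2≤k k<2ℓ trees pairs = no-room k (ℓ * 2) 2≤k k<2ℓ (begin
  ℓ * 2 * k + k                  ≡⟨ double-lhs ℓ k ⟩
  (ℓ * k + ℓ * k) + k            ≤⟨ +-monoˡ-≤ k (+-mono-≤ trees trees) ⟩
  ((m + ℓ) + (m + ℓ)) + k        ≡⟨ double-rhs m ℓ k ⟩
  (m + (m + k)) + ℓ * 2          ≤⟨ +-monoˡ-≤ (ℓ * 2) pairs ⟩
  k * k + ℓ * 2                  ∎)
  where
    open ≤-Reasoning
    double-lhs : ∀ ℓ k → ℓ * 2 * k + k ≡ (ℓ * k + ℓ * k) + k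
    double-lhs = solve-∀
    double-rhs : ∀ m ℓ k → ((m + ℓ) + (m + ℓ)) + k ≡ (m + (m + k)) + ℓ * 2
    double-rhs = solve-∀

module _ {a} {A : Set a} where

  remove : ∀ {x : A} (ys : List A) → x ∈ ys → List A
  remove (y ∷ ys) (here _)  = ys
  remove (y ∷ ys) (there p) = y ∷ remove ys p

  length-remove : ∀ {x : A} ys (p : x ∈ ys) → suc (length (remove ys p)) ≡ length ys
  length-remove (y ∷ ys) (here _)  = refl
  length-remove (y ∷ ys) (there p) = cong suc (length-remove ys p)

  ∈-remove : ∀ {x y : A} ys (p : x ∈ ys) → y ∈ ys → y ≢ x → y ∈ remove ys p
  ∈-remove (z ∷ ys) (here refl) (here refl) y≢x = ⊥-elim (y≢x refl)
  ∈-remove (z ∷ ys) (here refl) (there q)   y≢x = q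
  ∈-remove (z ∷ ys) (there p)   (here refl) y≢x = here refl
  ∈-remove (z ∷ ys) (there p)   (there q)   y≢x = there (∈-remove ys p q y≢x)

  unique-⊆⇒length≤ : ∀ {xs ys : List A} → Unique xs → (∀ {z} → z ∈ xs → z ∈ ys) →
                      length xs ≤ length ys
  unique-⊆⇒length≤ {[]}     _          _   = z≤n
  unique-⊆⇒length≤ {x ∷ xs} {ys} (x∉xs ∷ uxs) xs⊆ys =
    subst (suc (length xs) ≤_) (length-remove ys x∈ys) (s≤s (unique-⊆⇒length≤ uxs xs⊆ys-x))
    where
      x∈ys : x ∈ ys
      x∈ys = xs⊆ys (here refl)
      xs⊆ys-x : ∀ {z} → z ∈ xs → z ∈ remove ys x∈ys
      xs⊆ys-x z∈xs = ∈-remove ys x∈ys (xs⊆ys (there z∈xs)) λ z≡x → All.lookup x∉xs z∈xs (sym z≡x)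

  unique-constant⇒length≤1 : ∀ {xs : List A} → Unique xs → (∀ {x y} → x ∈ xs → y ∈ xs → x ≡ y) →
                              length xs ≤ 1
  unique-constant⇒length≤1 {[]}         _                 _  = z≤n
  unique-constant⇒length≤1 {x ∷ []}     _                 _  = s≤s z≤n
  unique-constant⇒length≤1 {x ∷ y ∷ xs} ((x≢y ∷ _) ∷ _) eq = ⊥-elim (x≢y (eq (here refl) (there (here refl))))

  filter-removes-≤1 : ∀ {p} {P : Pred A p} (P? : Decidable P) (xs : List A) → Unique xs →
                      (∀ {x y} → x ∈ xs → y ∈ xs → P x → P y → x ≡ y) →
                      length xs ≤ suc (length (filter (λ z → ¬? (P? z)) xs))
  filter-removes-≤1 P? []       _            _   = z≤n
  filter-removes-≤1 P? (x ∷ xs) (x∉xs ∷ uxs) at-most-one with P? x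
  ... | yes px = s≤s (≤-reflexive (sym (cong length (filter-all (λ z → ¬? (P? z))
                   (All.tabulate λ {z} z∈xs pz → All.lookup x∉xs z∈xs (at-most-one (here refl) (there z∈xs) px pz))))))
  ... | no _   = s≤s (filter-removes-≤1 P? xs uxs λ x∈ y∈ → at-most-one (there x∈) (there y∈))

  long-enough-⊆ : DecidableEquality A → ∀ {xs ys : List A} → Unique ys →
                  (∀ {z} → z ∈ ys → z ∈ xs) → length xs ≤ length ys →
                  ∀ {x} → x ∈ xs → x ∈ ys
  long-enough-⊆ _≟_ {xs} {ys} uys ys⊆xs |xs|≤|ys| {x} x∈xs with x ∈? ys
    where open DecMembership _≟_ using (_∈?_)
  ... | yes x∈ys = x∈ys
  ... | no  x∉ys = ⊥-elim (<⇒≱ (unique-⊆⇒length≤ (¬Any⇒All¬ ys x∉ys ∷ uys) x∷ys⊆xs) |xs|≤|ys|)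
    where
      x∷ys⊆xs : ∀ {z} → z ∈ x ∷ ys → z ∈ xs
      x∷ys⊆xs (here refl) = x∈xs
      x∷ys⊆xs (there z∈)  = ys⊆xs z∈

  two-values : ∀ {b} {B : Set b} (h : A → B) (xs : List A) → 2 ≤ length xs → Unique (map h xs) →
               (∀ {x y} → x ∈ xs → y ∈ xs → h x ≡ h y) → ⊥
  two-values h (x ∷ [])     (s≤s ())
  two-values h (x ∷ y ∷ xs) _ ((hx≢hy ∷ _) ∷ _) const = hx≢hy (const (here refl) (there (here refl)))

  length-cartesianProduct : ∀ {b} {B : Set b} (xs : List A) (ys : List B) →
                            length (cartesianProduct xs ys) ≡ length xs * length ys
  length-cartesianProduct []       ys = refl
  length-cartesianProduct (x ∷ xs) ys =
    trans (length-++ (map (x ,_) ys)) (cong₂ _+_ (length-map _ ys) (length-cartesianProduct xs ys))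

module _ {a i} {A : Set a} {I : Set i} (F : I → List A) where

  ∈-concatMap⁻ : ∀ is {x} → x ∈ concatMap F is → Σ I λ j → j ∈ is × x ∈ F j
  ∈-concatMap⁻ (i ∷ is) x∈ with ∈-++⁻ (F i) x∈
  ... | inj₁ x∈Fi = i , here refl , x∈Fi
  ... | inj₂ x∈rest with ∈-concatMap⁻ is x∈rest
  ...   | j , j∈is , x∈Fj = j , there j∈is , x∈Fj

  concatMap-unique : (∀ i → Unique (F i)) → (∀ i j → i ≢ j → ∀ x → x ∈ F i → x ∈ F j → ⊥) →
                     ∀ is → Unique is → Unique (concatMap F is)
  concatMap-unique uF disjoint []       _            = []
  concatMap-unique uF disjoint (i ∷ is) (i∉is ∷ uis) =
    UniqueP.++⁺ (uF i) (concatMap-unique uF disjoint is uis) λ { {x} (x∈Fi , x∈rest) →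
      let (j , j∈is , x∈Fj) = ∈-concatMap⁻ is x∈rest
      in disjoint i j (All.lookup i∉is j∈is) x x∈Fi x∈Fj }

  length-concatMap-≥ : ∀ {k} → (∀ i → k ≤ suc (length (F i))) →
                       ∀ is → length is * k ≤ length (concatMap F is) + length is
  length-concatMap-≥         big []       = z≤n
  length-concatMap-≥ {k} big (i ∷ is) = begin
    k + length is * k                                        ≤⟨ +-mono-≤ (big i) (length-concatMap-≥ big is) ⟩
    suc (length (F i)) + (length (concatMap F is) + length is) ≡⟨ regroup (length (F i)) _ _ ⟩
    (length (F i) + length (concatMap F is)) + suc (length is) ≡⟨ cong (_+ suc (length is)) (length-++ (F i)) ⟨
    length (F i ++ concatMap F is) + suc (length is)         ∎
    where
      open ≤-Reasoning
      regroup : ∀ a b c → suc a + (b + c) ≡ (a + b) + suc c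
      regroup = solve-∀

module _ {n : ℕ} where

  redirect : Fin n → Fin n → Fin n → Fin n
  redirect x y v with v Fin.≟ y
  ... | yes _ = x
  ... | no  _ = v

  redirect-target : ∀ x y → redirect x y y ≡ x
  redirect-target x y with y Fin.≟ y
  ... | yes _   = refl
  ... | no  y≢y = ⊥-elim (y≢y refl)

  redirect-source : ∀ x y → redirect x y x ≡ x
  redirect-source x y with x Fin.≟ y
  ... | yes _ = refl
  ... | no  _ = refl

  redirect-other : ∀ x y v → v ≢ y → redirect x y v ≡ v
  redirect-other x y v v≢y with v Fin.≟ y
  ... | yes v≡y = ⊥-elim (v≢y v≡y)
  ... | no  _   = refl

  -- A labelling of the vertices V that is constant along every edge of E,
  -- together with representatives R ⊆ V carrying pairwise distinct labels and
  -- |V| ≤ |R| + |E|.  (R has one vertex per component; each edge merges at most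
  -- two components.)
  record Labelling (E : List (Edge n)) (V : List (Fin n)) : Set where
    field
      label          : Fin n → Fin n
      label-edge     : All (λ e → label (proj₁ e) ≡ label (proj₂ e)) E
      reps           : List (Fin n)
      reps-unique    : Unique reps
      reps⊆V         : ∀ {z} → z ∈ reps → z ∈ V
      reps-distinct  : ∀ {x y} → x ∈ reps → y ∈ reps → label x ≡ label y → x ≡ y
      vertices-bound : length V ≤ length reps + length E

  -- Built edge by edge: the edge (a , b) merges the label of b into that of a,
  -- and the (at most one) representative with b's old label is dropped.
  labelling : ∀ (E : List (Edge n)) (V : List (Fin n)) → Unique V → Labelling E V
  labelling [] V uV = record
    { label = λ x → x ; label-edge = [] ; reps = V ; reps-unique = uV ; reps⊆V = λ z∈ → z∈
    ; reps-distinct = λ _ _ eq → eq ; vertices-bound = m≤m+n (length V) 0 }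
  labelling ((a , b) ∷ E) V uV = record
    { label          = merge ∘ label
    ; label-edge     = trans (redirect-source (label a) (label b)) (sym (redirect-target (label a) (label b)))
                       ∷ All.map (cong merge) label-edge
    ; reps           = reps'
    ; reps-unique    = UniqueP.filter⁺ kept? reps-unique
    ; reps⊆V         = λ z∈ → reps⊆V (proj₁ (∈-filter⁻ kept? z∈))
    ; reps-distinct  = λ {x} {y} x∈ y∈ eq →
        let (x∈reps , x-kept) = ∈-filter⁻ kept? x∈
            (y∈reps , y-kept) = ∈-filter⁻ kept? y∈
        in reps-distinct x∈reps y∈reps
             (trans (sym (redirect-other _ _ _ x-kept)) (trans eq (redirect-other _ _ _ y-kept)))
    ; vertices-bound = ≤-trans vertices-bound (≤-trans (+-monoˡ-≤ (length E) dropped-≤1)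
                                                (≤-reflexive (sym (+-suc (length reps') (length E)))))
    }
    where
      open Labelling (labelling E V uV)
      merge : Fin n → Fin n
      merge = redirect (label a) (label b)
      kept? : Decidable (λ r → label r ≢ label b)
      kept? r = ¬? (label r Fin.≟ label b)
      reps' : List (Fin n)
      reps' = filter kept? reps
      dropped-≤1 : length reps ≤ suc (length reps')
      dropped-≤1 = filter-removes-≤1 (λ r → label r Fin.≟ label b) reps reps-unique
                     λ x∈ y∈ x~b y~b → reps-distinct x∈ y∈ (trans x~b (sym y~b))

  walk-preserves-label : ∀ {E : List (Edge n)} (f : Fin n → Fin n) →
                         All (λ e → f (proj₁ e) ≡ f (proj₂ e)) E → ∀ {u v} → Walk E u v → f u ≡ f v
  walk-preserves-label f f-edge here               = refl
  walk-preserves-label f f-edge (step (inj₁ uw) w) = trans (All.lookup f-edge uw) (walk-preserves-label f f-edge w)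
  walk-preserves-label f f-edge (step (inj₂ wu) w) = trans (sym (All.lookup f-edge wu)) (walk-preserves-label f f-edge w)

  connected⇒vertices≤edges+1 : ∀ (E : List (Edge n)) (V : List (Fin n)) → Unique V →
                               (∀ u v → u ∈ V → v ∈ V → Walk E u v) → length V ≤ suc (length E)
  connected⇒vertices≤edges+1 E V uV connected =
    ≤-trans vertices-bound (+-monoˡ-≤ (length E) one-component)
    where
      open Labelling (labelling E V uV)
      one-component : length reps ≤ 1
      one-component = unique-constant⇒length≤1 reps-unique λ x∈ y∈ →
        reps-distinct x∈ y∈ (walk-preserves-label label label-edge (connected _ _ (reps⊆V x∈) (reps⊆V y∈)))

length-allFin : ∀ m → length (allFin m) ≡ m
length-allFin m = length-tabulate {n = m} (λ x → x)

rainbow⇒edges≤colours : ∀ {n t} (c : Coloring n t) (T : Tree n) → Rainbow c T → length (E T) ≤ t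
rainbow⇒edges≤colours {t = t} c T rainbow =
  subst₂ _≤_ (length-map _ (E T)) (length-allFin t) (unique-⊆⇒length≤ rainbow λ {z} _ → ∈-allFin z)

EdgeInside : ∀ {n} → List (Fin n) → Edge n → Set
EdgeInside S e = Canonical e × (proj₁ e ∈ S) × (proj₂ e ∈ S)

-- With fewer than k colours, a rainbow S-tree for a k-set S has k ≤ |V| ≤ |E| + 1
-- ≤ t + 1 ≤ k, so it spans exactly S: all its edges lie inside S, and it has at
-- least k - 1 of them.
small-rainbow-S-tree : ∀ {n t k} (c : Coloring n t) → t < k → (S : List (Fin n)) → KSubset n k S →
                       (T : Tree n) → IsSTree S T → Rainbow c T →
                       (∀ {e} → e ∈ E T → EdgeInside S e) × (k ≤ suc (length (E T)))
small-rainbow-S-tree {k = k} c t<k S (S-unique , |S|≡k) T S⊆V rainbow =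
  edges-inside , ≤-trans k≤|V| |V|≤|E|+1
  where
    |V|≤|E|+1 : length (V T) ≤ suc (length (E T))
    |V|≤|E|+1 = connected⇒vertices≤edges+1 (E T) (V T) (V-unique T) (connected T)
    |V|≤|S| : length (V T) ≤ length S
    |V|≤|S| = ≤-trans |V|≤|E|+1 (≤-trans (s≤s (rainbow⇒edges≤colours c T rainbow))
                                          (≤-trans t<k (≤-reflexive (sym |S|≡k))))
    k≤|V| : k ≤ length (V T)
    k≤|V| = subst (_≤ length (V T)) |S|≡k (unique-⊆⇒length≤ S-unique (S⊆V _))
    V⊆S : ∀ {v} → v ∈ V T → v ∈ S
    V⊆S = long-enough-⊆ Fin._≟_ S-unique (S⊆V _) |V|≤|S|
    edges-inside : ∀ {e} → e ∈ E T → EdgeInside S e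
    edges-inside e∈ = All.lookup (E-canon T) e∈ , V⊆S (proj₁ ends) , V⊆S (proj₂ ends)
      where ends = All.lookup (E-inV T) e∈

-- Distinct canonical edges inside S: together with their reversals and the
-- diagonal they are distinct ordered pairs of S, so 2 |L| + |S| ≤ |S|².
inside-edges-bound : ∀ {n} (S : List (Fin n)) (L : List (Edge n)) → Unique S → Unique L →
                     (∀ {e} → e ∈ L → EdgeInside S e) → length L + (length L + length S) ≤ length S * length S
inside-edges-bound {n} S L S-unique L-unique inside =
  subst₂ _≤_ |D| (length-cartesianProduct S S) (unique-⊆⇒length≤ D-unique D⊆S×S)
  where
    diagonal : Fin n → Edge n
    diagonal x = x , x
    D : List (Edge n)
    D = L ++ (map swap L ++ map diagonal S)
    |D| : length D ≡ length L + (length L + length S)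
    |D| = trans (length-++ L) (cong (length L +_)
            (trans (length-++ (map swap L)) (cong₂ _+_ (length-map swap L) (length-map diagonal S))))
    swapped-descending : ∀ {z} → z ∈ map swap L → proj₂ z Fin.< proj₁ z
    swapped-descending z∈ with (a , b) , e∈L , refl ← ∈-map⁻ swap z∈ = proj₁ (inside e∈L)
    diagonal-flat : ∀ {z} → z ∈ map diagonal S → proj₁ z ≡ proj₂ z
    diagonal-flat z∈ with x , _ , refl ← ∈-map⁻ diagonal z∈ = refl
    D-unique : Unique D
    D-unique = UniqueP.++⁺ L-unique
      (UniqueP.++⁺ (UniqueP.map⁺ (λ { {a , b} {c , d} refl → refl }) L-unique)
                   (UniqueP.map⁺ (cong proj₁) S-unique)
                   λ (p , q) → FinP.<-irrefl (sym (diagonal-flat q)) (swapped-descending p))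
      λ { (p , q) → case-rest (proj₁ (inside p)) (∈-++⁻ (map swap L) q) }
      where
        case-rest : ∀ {z} → Canonical z → (z ∈ map swap L) ⊎ (z ∈ map diagonal S) → ⊥
        case-rest z-canon (inj₁ q) = FinP.<-asym z-canon (swapped-descending q)
        case-rest z-canon (inj₂ q) = FinP.<-irrefl (diagonal-flat q) z-canon
    D⊆S×S : ∀ {z} → z ∈ D → z ∈ cartesianProduct S S
    D⊆S×S z∈ with ∈-++⁻ L z∈
    ... | inj₁ z∈L = ∈-cartesianProduct⁺ (proj₁ (proj₂ (inside z∈L))) (proj₂ (proj₂ (inside z∈L)))
    ... | inj₂ z∈rest with ∈-++⁻ (map swap L) z∈rest
    ...   | inj₁ z∈swap with (a , b) , e∈L , refl ← ∈-map⁻ swap z∈swap =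
            ∈-cartesianProduct⁺ (proj₂ (proj₂ (inside e∈L))) (proj₁ (proj₂ (inside e∈L)))
    ...   | inj₂ z∈diag with x , x∈S , refl ← ∈-map⁻ diagonal z∈diag = ∈-cartesianProduct⁺ x∈S x∈S

embed-KSubset : ∀ {N n k} (N≤n : N ≤ n) {X : List (Fin N)} → KSubset N k X →
                KSubset n k (map (λ x → inject≤ x N≤n) X)
embed-KSubset N≤n {X} (X-unique , |X|≡k) =
  UniqueP.map⁺ (λ {x} {y} → FinP.inject≤-injective N≤n N≤n x y) X-unique ,
  trans (length-map (λ x → inject≤ x N≤n) X) |X|≡k

restrict : ∀ {N n t r} → N ≤ n → t ≤ r → Coloring n t → Coloring N r
restrict N≤n t≤r c = record
  { col = λ x y → inject≤ (col c (inject≤ x N≤n) (inject≤ y N≤n)) t≤r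
  ; sym = λ x y → cong (λ z → inject≤ z t≤r) (Coloring.sym c _ _) }

Monochromatic : ∀ {n t} → Coloring n t → List (Fin n) → Set
Monochromatic c S = ∀ {u v u' v'} → u ∈ S → v ∈ S → u ≢ v → u' ∈ S → v' ∈ S → u' ≢ v' →
                    col c u v ≡ col c u' v'

-- A set that is monochromatic for the restricted colouring is monochromatic
-- for the original one (the palette embedding is injective).
restrict-monochromatic : ∀ {N n t r} (N≤n : N ≤ n) (t≤r : t ≤ r) (c : Coloring n t) {X : List (Fin N)} {a : Fin r} →
                         (∀ x y → x ∈ X → y ∈ X → x ≢ y → col (restrict N≤n t≤r c) x y ≡ a) →
                         Monochromatic c (map (λ x → inject≤ x N≤n) X)
restrict-monochromatic N≤n t≤r c mono u∈ v∈ u≢v u'∈ v'∈ u'≢v'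
  with x , x∈X , refl ← ∈-map⁻ _ u∈
  with y , y∈X , refl ← ∈-map⁻ _ v∈
  with x' , x'∈X , refl ← ∈-map⁻ _ u'∈
  with y' , y'∈X , refl ← ∈-map⁻ _ v'∈
  = FinP.inject≤-injective t≤r t≤r _ _
      (trans (mono x y x∈X y∈X (u≢v ∘ cong embed)) (sym (mono x' y' x'∈X y'∈X (u'≢v' ∘ cong embed))))
  where
    embed : Fin _ → Fin _
    embed z = inject≤ z N≤n

monochromatic⇒not-rainbow : ∀ {n t} (c : Coloring n t) (S : List (Fin n)) → Monochromatic c S →
                            (T : Tree n) → (∀ {e} → e ∈ E T → EdgeInside S e) → 2 ≤ length (E T) →
                            ¬ Rainbow c T
monochromatic⇒not-rainbow c S mono T inside two-edges rainbow =
  two-values colour (E T) two-edges rainbow one-colour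
  where
    colour : Edge _ → Fin _
    colour e = col c (proj₁ e) (proj₂ e)
    one-colour : ∀ {e e'} → e ∈ E T → e' ∈ E T → colour e ≡ colour e'
    one-colour e∈ e'∈ =
      let (u<v , u∈S , v∈S) = inside e∈
          (u'<v' , u'∈S , v'∈S) = inside e'∈
      in mono u∈S v∈S (FinP.<⇒≢ u<v) u'∈S v'∈S (FinP.<⇒≢ u'<v')

-- The first N vertices contain a monochromatic k-set S, and a
-- rainbow S-tree would have k - 1 ≥ 2 edges, all inside S.
ramsey⇒rx≥k : ∀ k ℓ → k ≥ 3 → ℓ ≥ 1 → ∀ N → RamseyProperty (k ∸ 1) k N →
              ∀ n → n ≥ N → RxAtLeast k ℓ n k
ramsey⇒rx≥k k (suc ℓ) k≥3 _ N ramsey n N≤n t t<k c rainbowKL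
  with X , _ , X-kset , X-monochromatic ← ramsey (restrict N≤n (suc[m]≤n⇒m≤pred[n] t<k) c) =
  monochromatic⇒not-rainbow c S (restrict-monochromatic N≤n (suc[m]≤n⇒m≤pred[n] t<k) c X-monochromatic) T
    (proj₁ shape) (≤-pred (≤-trans k≥3 (proj₂ shape))) T-rainbow
  where
    S : List (Fin n)
    S = map (λ x → inject≤ x N≤n) X
    S-kset : KSubset n k S
    S-kset = embed-KSubset N≤n X-kset
    T : Tree n
    T = proj₁ (rainbowKL S S-kset) Fin.zero
    T-rainbow : Rainbow c T
    T-rainbow = proj₂ (proj₁ (proj₂ (rainbowKL S S-kset)) Fin.zero)
    shape : (∀ {e} → e ∈ E T → EdgeInside S e) × (k ≤ suc (length (E T)))
    shape = small-rainbow-S-tree c t<k S S-kset T (proj₁ (proj₁ (proj₂ (rainbowKL S S-kset)) Fin.zero)) T-rainbow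

-- Part (i): with ℓ > ⌊k/2⌋ trees, on the first k vertices S.  The trees are
-- edge-disjoint, each has at least k - 1 edges inside S, and their union L
-- must fit among the pairs of S.
many-trees⇒rx≥k : ∀ k ℓ → k ≥ 3 → ℓ > k / 2 → ∀ n → n ≥ k → RxAtLeast k ℓ n k
many-trees⇒rx≥k k ℓ k≥3 ℓ>k/2 n k≤n t t<k c rainbowKL =
  too-many-edges k ℓ (length L) (≤-trans (n≤1+n 2) k≥3) (floor-half<⇒< k ℓ ℓ>k/2) L-long L-short
  where
    S : List (Fin n)
    S = map (λ x → inject≤ x k≤n) (allFin k)
    S-kset : KSubset n k S
    S-kset = embed-KSubset k≤n (UniqueP.allFin⁺ k , length-allFin k)
    trees : Fin ℓ → Tree n
    trees = proj₁ (rainbowKL S S-kset)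
    edges : Fin ℓ → List (Edge n)
    edges i = E (trees i)
    shape : ∀ i → (∀ {e} → e ∈ edges i → EdgeInside S e) × (k ≤ suc (length (edges i)))
    shape i = let (S-tree , rainbow) = proj₁ (proj₂ (rainbowKL S S-kset)) i
              in small-rainbow-S-tree c t<k S S-kset (trees i) S-tree rainbow
    L : List (Edge n)
    L = concatMap edges (allFin ℓ)
    L-unique : Unique L
    L-unique = concatMap-unique edges (λ i → E-unique (trees i))
                 (λ i j i≢j → proj₁ (proj₂ (proj₂ (rainbowKL S S-kset)) i j i≢j)) (allFin ℓ) (UniqueP.allFin⁺ ℓ)
    L-inside : ∀ {e} → e ∈ L → EdgeInside S e
    L-inside e∈ with j , _ , e∈Tj ← ∈-concatMap⁻ edges (allFin ℓ) e∈ = proj₁ (shape j) e∈Tj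
    L-long : ℓ * k ≤ length L + ℓ
    L-long = subst (λ m → m * k ≤ length L + m) (length-allFin ℓ)
               (length-concatMap-≥ edges (λ i → proj₂ (shape i)) (allFin ℓ))
    L-short : length L + (length L + k) ≤ k * k
    L-short = subst (λ m → length L + (length L + m) ≤ m * m) (proj₂ S-kset)
                (inside-edges-bound S L (proj₁ S-kset) L-unique L-inside)

lemma2p3 : ∀ (k ℓ : ℕ) → k ≥ 3 → ℓ ≥ 1 →
    ((ℓ > k / 2 → ∀ n → n ≥ k → RxAtLeast k ℓ n k)
    × (ℓ ≤ k / 2 → ∀ N → IsRamseyNumber (k ∸ 1) k N → ∀ n → n ≥ N → RxAtLeast k ℓ n k))
lemma2p3 k ℓ k≥3 ℓ≥1 =
  many-trees⇒rx≥k k ℓ k≥3 ,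
  λ _ N N-is-Ramsey → ramsey⇒rx≥k k ℓ k≥3 ℓ≥1 N (proj₁ N-is-Ramsey)
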